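{- Let $k\geq 2$ and let $\Phi$ be a $k$-vertex graph property that is fully symmetric and not $k$-trivial. Let $\ell\geq 2$ be maximal such that there is a prime $p$ with \[\binom{\ell}{2}+1\leq p\leq\binom{k}{2}+1.\] Then there is a $k$-vertex graph $H$ such that $\widehat{\Phi}(H)\neq 0$ and the complete graph $K_\ell$ is a subgraph of $H$.
   Context: All graphs are finite, simple and undirected. A $k$-vertex graph property is an isomorphism-invariant map $\Phi$ from graphs to $\{0,1\}$ with $\Phi(G)=0$ whenever $|V(G)|\neq k$. It is fully symmetric if $\Phi(G)=\Phi(G')$ for all $k$-vertex graphs with $|E(G)|=|E(G')|$, and $k$-trivial if constant on $k$-vertex graphs. The alternating enumerator is $\widehat{\Phi}(H)=(-1)^{|E(H)|}\sum_{S\subseteq E(H)}(-1)^{|S|}\Phi(H[S])$, where $H[S]=(V(H),S)$. -}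

module Defs where

open import Data.Bool using (Bool; true; false; _∧_; if_then_else_)
open import Data.Nat using (ℕ; zero; suc; _+_; _≤_)
open import Data.Nat.Combinatorics using (_C_)
open import Data.Nat.Primality using (Prime)
open import Data.Integer as ℤ using (ℤ; +_; -_)
open import Data.Fin using (Fin; _<_; _<?_; _≟_)
open import Data.Fin.Permutation using (Permutation′; _⟨$⟩ʳ_)
open import Data.List using (List; []; _∷_; map; foldr; length; filterᵇ; allFin; cartesianProduct)
open import Data.Bool.ListAction using (any)
open import Data.Product using (Σ; _×_; _,_; proj₁; proj₂; ∃)
open import Function.Definitions using (Injective)
open import Relation.Nullary using (¬_; yes; no)
open import Relation.Nullary.Decidable using (⌊_⌋)
open import Relation.Binary.PropositionalEquality using (_≡_; _≢_)

UPair : ℕ → Set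
UPair k = Σ (Fin k × Fin k) (λ p → proj₁ p < proj₂ p)

collect : ∀ {k} → List (Fin k × Fin k) → List (UPair k)
collect [] = []
collect ((i , j) ∷ xs) with i <? j
... | yes p = ((i , j) , p) ∷ collect xs
... | no _  = collect xs

allPairs : (k : ℕ) → List (UPair k)
allPairs k = collect (cartesianProduct (allFin k) (allFin k))

Graph : ℕ → Set
Graph k = UPair k → Bool

adj : ∀ {k} → Graph k → Fin k → Fin k → Bool
adj G i j with i <? j | j <? i
... | yes p | _     = G ((i , j) , p)
... | no _  | yes q = G ((j , i) , q)
... | no _  | no _  = false

edges : ∀ {k} → Graph k → List (UPair k)
edges {k} G = filterᵇ G (allPairs k)

numEdges : ∀ {k} → Graph k → ℕ
numEdges G = length (edges G)

Iso : ∀ {k} → Permutation′ k → Graph k → Graph k → Set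
Iso σ G G' = ∀ i j → adj G' (σ ⟨$⟩ʳ i) (σ ⟨$⟩ʳ j) ≡ adj G i j

-- A k-vertex graph property (restricted to graphs on vertex set Fin k),
-- with value in {0,1} encoded as Bool, isomorphism invariant.
IsGraphProperty : ∀ {k} → (Graph k → Bool) → Set
IsGraphProperty {k} Φ = ∀ (σ : Permutation′ k) (G G' : Graph k) → Iso σ G G' → Φ G ≡ Φ G'

FullySymmetric : ∀ {k} → (Graph k → Bool) → Set
FullySymmetric {k} Φ = ∀ (G G' : Graph k) → numEdges G ≡ numEdges G' → Φ G ≡ Φ G'

Trivial : ∀ {k} → (Graph k → Bool) → Set
Trivial {k} Φ = ∀ (G G' : Graph k) → Φ G ≡ Φ G'

sublists : ∀ {A : Set} → List A → List (List A)
sublists [] = [] ∷ []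
sublists (x ∷ xs) = map (x ∷_) (sublists xs) Data.List.++ sublists xs

eqPair : ∀ {k} → UPair k → UPair k → Bool
eqPair ((i , j) , _) ((i' , j') , _) = ⌊ i ≟ i' ⌋ ∧ ⌊ j ≟ j' ⌋

spanning : ∀ {k} → List (UPair k) → Graph k
spanning S e = any (eqPair e) S

sign : ℕ → ℤ
sign zero = + 1
sign (suc n) = - sign n

toℤ : Bool → ℤ
toℤ true = + 1
toℤ false = + 0

sumℤ : List ℤ → ℤ
sumℤ = foldr ℤ._+_ (+ 0)

altEnum : ∀ {k} → (Graph k → Bool) → Graph k → ℤ
altEnum Φ H = sign (numEdges H) ℤ.* sumℤ (map (λ S → sign (length S) ℤ.* toℤ (Φ (spanning S))) (sublists (edges H)))

HasCliqueSubgraph : ∀ {k} → ℕ → Graph k → Set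
HasCliqueSubgraph {k} ℓ H = Σ (Fin ℓ → Fin k) λ f → Injective _≡_ _≡_ f × (∀ i j → i ≢ j → adj H (f i) (f j) ≡ true)

PrimeWindow : ℕ → ℕ → Set
PrimeWindow k ℓ = ∃ λ p → Prime p × (ℓ C 2 + 1 ≤ p) × (p ≤ k C 2 + 1)

module Submission where

-- Since Φ is fully symmetric, Φ G = φ |E(G)| for a single φ : ℕ → Bool, and grouping the
-- subsets of E(H) by size gives Φ̂(H) = ± Σ_j (-1)^j (m C j) φ(j) with m = |E(H)|.
-- For the prime p = q + 1 of the window, (-1)^j (q C j) ≡ 1 (mod p).  If the alternating
-- sum vanished for every m with q ≤ m ≤ (k C 2), the same would hold for every shift
-- φ (s + _) with s + q ≤ (k C 2), so each block of p consecutive values of φ would contain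
-- a multiple of p trues, i.e. be constant; overlapping blocks would make φ, hence Φ,
-- constant.  So it is nonzero for some m ≥ q ≥ (ℓ C 2), and the graph formed by the first m
-- pairs of an enumeration listing the pairs among the top ℓ vertices first contains K_ℓ.

open import Defs
open import Data.Bool using (Bool; true; false; T)
open import Data.Bool.Properties using (T-≡)
open import Data.Nat as ℕ using (ℕ; zero; suc; _≤_; _<_; z≤n; s≤s; z<s; s<s; _∸_; _!; _≤?_)
import Data.Nat.Properties as ℕ
open import Data.Nat.Combinatorics using (_C_; nCk+nC[k+1]≡[n+1]C[k+1]; nC1≡n; nCk≡n!/k![n-k]!; k![n∸k]!∣n!)
open import Data.Nat.Divisibility as ℕ∣ using (>⇒∤; ∣1⇒≡1; m∣m*n)
open import Data.Nat.DivMod using (m/n*n≡m)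
open import Data.Nat.Primality using (Prime; euclidsLemma; ¬prime[0]; ¬prime[1])
open import Data.Integer as ℤ using (ℤ; +_; -_; _+_; _-_; _*_; 0ℤ; 1ℤ)
import Data.Integer.Properties as ℤ
open import Data.Integer.Divisibility.Signed
  using (_∣_; divides; ∣m∣n⇒∣m+n; ∣m∣n⇒∣m-n; ∣n⇒∣m*n; ∣m⇒∣m*n; ∣ᵤ⇒∣; ∣⇒∣ᵤ)
open import Data.Integer.Tactic.RingSolver using (solve-∀)
open import Data.Fin as Fin using (Fin)
import Data.Fin.Properties as Finₚ
open import Data.List using (List; []; _∷_; _++_; map; length; filter; take; applyUpTo; allFin; cartesianProduct)
open import Data.List.Properties
  using ( length-++; length-map; length-tabulate; length-take; length-filter; length-applyUpTo
        ; map-++; map-∘; map-cong; map-cong-local; map-applyUpTo; take-all; take-map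
        ; filter-some; filter-notAll; filter-accept; filter-reject; filter-all )
open import Data.List.Membership.Propositional using (_∈_)
open import Data.List.Membership.Propositional.Properties
  using (∈-applyUpTo⁺; ∈-map⁺; ∈-map⁻; ∈-++⁺ˡ; ∈-++⁺ʳ; ∈-filter⁺; ∈-filter⁻; ∈-cartesianProduct⁺; ∈-allFin)
open import Data.List.Membership.Propositional.Properties.WithK using (unique∧set⇒bag)
open import Data.List.Relation.Unary.All as All using (All; []; _∷_)
import Data.List.Relation.Unary.All.Properties as Allₚ
open import Data.List.Relation.Unary.AllPairs using ([]; _∷_)
open import Data.List.Relation.Unary.Any as Any using (here; there)
open import Data.List.Relation.Unary.Any.Properties using (any⇔)
open import Data.List.Relation.Unary.Unique.Propositional using (Unique)
import Data.List.Relation.Unary.Unique.Propositional.Properties as Unique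
open import Data.List.Relation.Binary.Sublist.Propositional using (_⊆_; []; _∷_; _∷ʳ_)
open import Data.List.Relation.Binary.Sublist.Propositional.Properties using (All-resp-⊆)
open import Data.List.Relation.Binary.Disjoint.Propositional using (Disjoint)
open import Data.List.Relation.Binary.BagAndSetEquality using (∼bag⇒↭)
open import Data.List.Relation.Binary.Permutation.Propositional.Properties using (↭-length)
open import Data.Product using (Σ; _×_; _,_; proj₁; proj₂; ∃)
open import Data.Sum using (_⊎_; inj₁; inj₂; [_,_]′)
open import Function using (_∘_; id)
open import Function.Bundles using (_⇔_; mk⇔; Equivalence)
open import Function.Definitions using (Injective)
open import Relation.Nullary using (Dec; ¬_; contradiction; yes; no; ¬?; _×-dec_)
open import Relation.Nullary.Decidable using (T?; decidable-stable)
open import Relation.Binary.PropositionalEquality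

-- Alternating binomial sums

-- Σ_{j ≤ n} (-1)^j (n C j) F j, i.e. (-1)^n times the n-th forward difference of F at 0.
altBinomialSum : (ℕ → ℤ) → ℕ → ℤ
altBinomialSum F zero    = F 0
altBinomialSum F (suc n) = altBinomialSum F n - altBinomialSum (F ∘ suc) n

altBinomialSum-shift : ∀ F n → altBinomialSum (F ∘ suc) n ≡ altBinomialSum F n - altBinomialSum F (suc n)
altBinomialSum-shift F n = undo (altBinomialSum F n) (altBinomialSum (F ∘ suc) n)
  where
  undo : ∀ x y → y ≡ x - (x - y)
  undo = solve-∀

sumBelow : ℕ → (ℕ → ℤ) → ℤ
sumBelow n g = sumℤ (applyUpTo g n)

sumBelow-cong : ∀ n {g h : ℕ → ℤ} → (∀ j → g j ≡ h j) → sumBelow n g ≡ sumBelow n h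
sumBelow-cong zero    g≗h = refl
sumBelow-cong (suc n) g≗h = cong₂ _+_ (g≗h 0) (sumBelow-cong n (g≗h ∘ suc))

sumBelow-zero : ∀ n {g : ℕ → ℤ} → (∀ j → g j ≡ 0ℤ) → sumBelow n g ≡ 0ℤ
sumBelow-zero zero    g≗0 = refl
sumBelow-zero (suc n) g≗0 = cong₂ _+_ (g≗0 0) (sumBelow-zero n (g≗0 ∘ suc))

sumBelow-sub : ∀ n (g h : ℕ → ℤ) → sumBelow n (λ j → g j - h j) ≡ sumBelow n g - sumBelow n h
sumBelow-sub zero    g h = refl
sumBelow-sub (suc n) g h = begin
  (g 0 - h 0) + sumBelow n (λ j → g (suc j) - h (suc j))
    ≡⟨ cong (λ s → (g 0 - h 0) + s) (sumBelow-sub n (g ∘ suc) (h ∘ suc)) ⟩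
  (g 0 - h 0) + (sumBelow n (g ∘ suc) - sumBelow n (h ∘ suc))
    ≡⟨ interchange (g 0) (h 0) _ _ ⟩
  (g 0 + sumBelow n (g ∘ suc)) - (h 0 + sumBelow n (h ∘ suc)) ∎
  where
  open ≡-Reasoning
  interchange : ∀ a b c d → (a - b) + (c - d) ≡ (a + c) - (b + d)
  interchange = solve-∀

∣-sumBelow : ∀ {d} n {g : ℕ → ℤ} → (∀ j → j < n → d ∣ g j) → d ∣ sumBelow n g
∣-sumBelow zero    d∣g = divides 0ℤ refl
∣-sumBelow (suc n) d∣g = ∣m∣n⇒∣m+n (d∣g 0 z<s) (∣-sumBelow n (λ j j<n → d∣g (suc j) (s<s j<n)))

signedBinomial : ℕ → ℕ → ℤ
signedBinomial n j = sign j * + (n C j)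

signedBinomial-pascal : ∀ n j →
  signedBinomial (suc n) (suc j) ≡ signedBinomial n (suc j) - signedBinomial n j
signedBinomial-pascal n j = begin
  - sign j * + (suc n C suc j)                  ≡⟨ cong (λ c → - sign j * + c) (sym (nCk+nC[k+1]≡[n+1]C[k+1] n j)) ⟩
  - sign j * + (n C j ℕ.+ n C suc j)            ≡⟨ cong (- sign j *_) (ℤ.pos-+ (n C j) (n C suc j)) ⟩
  - sign j * (+ (n C j) + + (n C suc j))        ≡⟨ distrib (sign j) (+ (n C j)) (+ (n C suc j)) ⟩
  - sign j * + (n C suc j) - sign j * + (n C j) ∎
  where
  open ≡-Reasoning
  distrib : ∀ s a b → - s * (a + b) ≡ - s * b - s * a
  distrib = solve-∀

-- Any number M > n of terms may be taken, since (n C j) = 0 for j > n.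
altBinomialSum-expansion : ∀ F {n M} → n < M →
  altBinomialSum F n ≡ sumBelow M (λ j → signedBinomial n j * F j)
altBinomialSum-expansion F {zero} {suc M} _ = sym (begin
  1ℤ * F 0 + sumBelow M (λ j → signedBinomial 0 (suc j) * F (suc j))
    ≡⟨ cong₂ _+_ (ℤ.*-identityˡ (F 0)) (sumBelow-zero M (λ j → cong (_* F (suc j)) (ℤ.*-zeroʳ (sign (suc j))))) ⟩
  F 0 + 0ℤ
    ≡⟨ ℤ.+-identityʳ (F 0) ⟩
  F 0 ∎)
  where open ≡-Reasoning
altBinomialSum-expansion F {suc n} {suc M} (s<s n<M) = begin
  altBinomialSum F n - altBinomialSum (F ∘ suc) n
    ≡⟨ cong₂ _-_ (altBinomialSum-expansion F (ℕ.m<n⇒m<1+n n<M)) (altBinomialSum-expansion (F ∘ suc) n<M) ⟩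
  (1ℤ * F 0 + sumBelow M (λ j → c (suc j) * F (suc j))) - sumBelow M (λ j → c j * F (suc j))
    ≡⟨ reassoc (1ℤ * F 0) _ _ ⟩
  1ℤ * F 0 + (sumBelow M (λ j → c (suc j) * F (suc j)) - sumBelow M (λ j → c j * F (suc j)))
    ≡⟨ cong (λ s → 1ℤ * F 0 + s) (sym (sumBelow-sub M _ _)) ⟩
  1ℤ * F 0 + sumBelow M (λ j → c (suc j) * F (suc j) - c j * F (suc j))
    ≡⟨ cong (λ s → 1ℤ * F 0 + s) (sumBelow-cong M pascal) ⟩
  1ℤ * F 0 + sumBelow M (λ j → signedBinomial (suc n) (suc j) * F (suc j)) ∎
  where
  open ≡-Reasoning
  c = signedBinomial n
  reassoc : ∀ a b d → (a + b) - d ≡ a + (b - d)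
  reassoc = solve-∀
  pascal : ∀ j → c (suc j) * F (suc j) - c j * F (suc j) ≡ signedBinomial (suc n) (suc j) * F (suc j)
  pascal j = trans (factor (c (suc j)) (c j) (F (suc j)))
                   (cong (_* F (suc j)) (sym (signedBinomial-pascal n j)))
    where
    factor : ∀ a b x → a * x - b * x ≡ (a - b) * x
    factor = solve-∀

-- Binomial coefficients modulo a prime

prime∤m! : ∀ {p m} → Prime p → m < p → ¬ (p ℕ∣.∣ m !)
prime∤m! {m = zero}  isPrime _   p∣1  = ¬prime[1] (subst Prime (∣1⇒≡1 p∣1) isPrime)
prime∤m! {m = suc m} isPrime m<p p∣m! with euclidsLemma (suc m) (m !) isPrime p∣m!
... | inj₁ p∣1+m = >⇒∤ m<p p∣1+m
... | inj₂ p∣m!  = prime∤m! isPrime (ℕ.<-trans (ℕ.n<1+n m) m<p) p∣m!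

prime∣pCk : ∀ {p k} → Prime p → 0 < k → k < p → p ℕ∣.∣ p C k
prime∣pCk {suc n} {k} isPrime 0<k k<p with euclidsLemma (suc n C k) d isPrime p∣pCk*d
  where
  d = k ! ℕ.* (suc n ∸ k) !
  pCk*d≡p! : (suc n C k) ℕ.* d ≡ suc n !
  pCk*d≡p! = trans (cong (ℕ._* d) (nCk≡n!/k![n-k]! (ℕ.<⇒≤ k<p)))
                   (m/n*n≡m {{ℕ._!*_!≢0 k (suc n ∸ k)}} (k![n∸k]!∣n! (ℕ.<⇒≤ k<p)))
  p∣pCk*d : suc n ℕ∣.∣ (suc n C k) ℕ.* d
  p∣pCk*d = subst (suc n ℕ∣.∣_) (sym pCk*d≡p!) (m∣m*n (n !))
... | inj₁ p∣pCk = p∣pCk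
... | inj₂ p∣d with euclidsLemma (k !) ((suc n ∸ k) !) isPrime p∣d
...   | inj₁ p∣k!     = contradiction p∣k! (prime∤m! isPrime k<p)
...   | inj₂ p∣[p-k]! = contradiction p∣[p-k]! (prime∤m! isPrime (ℕ.∸-monoʳ-< 0<k (ℕ.<⇒≤ k<p)))

signedBinomial≡1-mod-prime : ∀ {q} → Prime (suc q) → ∀ {j} → j ≤ q → + suc q ∣ 1ℤ - signedBinomial q j
signedBinomial≡1-mod-prime isPrime {zero}  _   = divides 0ℤ refl
signedBinomial≡1-mod-prime {q} isPrime {suc j} j<q =
  subst (+ suc q ∣_) (sym split) (∣m∣n⇒∣m-n (signedBinomial≡1-mod-prime isPrime (ℕ.<⇒≤ j<q)) p∣±pCj)
  where
  split : 1ℤ - signedBinomial q (suc j) ≡ (1ℤ - signedBinomial q j) - signedBinomial (suc q) (suc j)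
  split = trans (telescope (signedBinomial q (suc j)) (signedBinomial q j))
                (cong (λ c → (1ℤ - signedBinomial q j) - c) (sym (signedBinomial-pascal q j)))
    where
    telescope : ∀ a b → 1ℤ - a ≡ (1ℤ - b) - (a - b)
    telescope = solve-∀
  p∣±pCj : + suc q ∣ signedBinomial (suc q) (suc j)
  p∣±pCj = ∣n⇒∣m*n (sign (suc j)) (∣ᵤ⇒∣ (prime∣pCk isPrime z<s (s<s j<q)))

sumBelow≡altBinomialSum-mod-prime : ∀ {q} → Prime (suc q) → ∀ F →
  + suc q ∣ sumBelow (suc q) F - altBinomialSum F q
sumBelow≡altBinomialSum-mod-prime {q} isPrime F = subst (+ suc q ∣_) rearrange
  (∣-sumBelow (suc q) λ j j≤q → ∣m⇒∣m*n (F j) (signedBinomial≡1-mod-prime isPrime (ℕ.≤-pred j≤q)))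
  where
  open ≡-Reasoning
  c = signedBinomial q
  rearrange : sumBelow (suc q) (λ j → (1ℤ - c j) * F j) ≡ sumBelow (suc q) F - altBinomialSum F q
  rearrange = begin
    sumBelow (suc q) (λ j → (1ℤ - c j) * F j)         ≡⟨ sumBelow-cong (suc q) (λ j → expand (c j) (F j)) ⟩
    sumBelow (suc q) (λ j → F j - c j * F j)          ≡⟨ sumBelow-sub (suc q) F (λ j → c j * F j) ⟩
    sumBelow (suc q) F - sumBelow (suc q) (λ j → c j * F j)
      ≡⟨ cong (λ s → sumBelow (suc q) F - s) (sym (altBinomialSum-expansion F {q} ℕ.≤-refl)) ⟩
    sumBelow (suc q) F - altBinomialSum F q ∎
    where
    expand : ∀ a x → (1ℤ - a) * x ≡ x - a * x
    expand = solve-∀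

-- Boolean sequences whose alternating binomial sums vanish

VanishesBetween : (ℕ → ℤ) → ℕ → ℕ → Set
VanishesBetween F q N = ∀ m → q ≤ m → m ≤ N → altBinomialSum F m ≡ 0ℤ

vanishesBetween-suc : ∀ {F q N} → VanishesBetween F q (suc N) → VanishesBetween (F ∘ suc) q N
vanishesBetween-suc {F} vanish m q≤m m≤N = begin
  altBinomialSum (F ∘ suc) m                    ≡⟨ altBinomialSum-shift F m ⟩
  altBinomialSum F m - altBinomialSum F (suc m) ≡⟨ cong₂ _-_ (vanish m q≤m (ℕ.m≤n⇒m≤1+n m≤N))
                                                             (vanish (suc m) (ℕ.m≤n⇒m≤1+n q≤m) (s≤s m≤N)) ⟩
  0ℤ - 0ℤ                                       ≡⟨⟩
  0ℤ                                            ∎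
  where open ≡-Reasoning

vanishesBetween-shift : ∀ {F q N} s → VanishesBetween F q (s ℕ.+ N) → VanishesBetween (F ∘ (s ℕ.+_)) q N
vanishesBetween-shift zero    vanish = vanish
vanishesBetween-shift (suc s) vanish = vanishesBetween-shift s (vanishesBetween-suc vanish)

sumℤ-toℤ : ∀ bs → sumℤ (map toℤ bs) ≡ + length (filter T? bs)
sumℤ-toℤ []           = refl
sumℤ-toℤ (true  ∷ bs) = cong (ℤ._+_ 1ℤ) (sumℤ-toℤ bs)
sumℤ-toℤ (false ∷ bs) = trans (ℤ.+-identityˡ _) (sumℤ-toℤ bs)

mixed⇒length∤trues : ∀ bs → true ∈ bs → false ∈ bs → ¬ (+ length bs ∣ sumℤ (map toℤ bs))
mixed⇒length∤trues bs true∈bs false∈bs n∣sum = >⇒∤ {{ℕ.>-nonZero 0<trues}} trues<n n∣trues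
  where
  0<trues : 0 < length (filter T? bs)
  0<trues = filter-some T? (Any.map (λ { refl → _ }) true∈bs)
  trues<n : length (filter T? bs) < length bs
  trues<n = filter-notAll T? bs (Any.map (λ { refl () }) false∈bs)
  n∣trues : length bs ℕ∣.∣ length (filter T? bs)
  n∣trues = subst (λ x → length bs ℕ∣.∣ ℤ.∣ x ∣) (sumℤ-toℤ bs) (∣⇒∣ᵤ n∣sum)

length∣trues⇒constant : ∀ bs → + length bs ∣ sumℤ (map toℤ bs) → ∀ {x y} → x ∈ bs → y ∈ bs → x ≡ y
length∣trues⇒constant bs n∣sum {true}  {true}  _        _        = refl
length∣trues⇒constant bs n∣sum {false} {false} _        _        = refl
length∣trues⇒constant bs n∣sum {true}  {false} true∈bs  false∈bs = contradiction n∣sum (mixed⇒length∤trues bs true∈bs false∈bs)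
length∣trues⇒constant bs n∣sum {false} {true}  false∈bs true∈bs  = contradiction n∣sum (mixed⇒length∤trues bs true∈bs false∈bs)

altBinomialSum≡0⇒window-constant : ∀ {q} → Prime (suc q) → (b : ℕ → Bool) (s : ℕ) →
  altBinomialSum (toℤ ∘ b ∘ (s ℕ.+_)) q ≡ 0ℤ → ∀ i → s ≤ i → i ≤ s ℕ.+ q → b i ≡ b s
altBinomialSum≡0⇒window-constant {q} isPrime b s vanish i s≤i i≤s+q =
  length∣trues⇒constant window p∣trues (member s≤i i≤s+q) (member ℕ.≤-refl (ℕ.m≤m+n s q))
  where
  window = applyUpTo (b ∘ (s ℕ.+_)) (suc q)
  member : ∀ {i} → s ≤ i → i ≤ s ℕ.+ q → b i ∈ window
  member {i} s≤i i≤s+q = subst (λ n → b n ∈ window) (ℕ.m+[n∸m]≡n s≤i)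
    (∈-applyUpTo⁺ (b ∘ (s ℕ.+_)) (s≤s (ℕ.m≤n+o⇒m∸n≤o i s i≤s+q)))
  F = toℤ ∘ b ∘ (s ℕ.+_)
  p∣sum : + suc q ∣ sumBelow (suc q) F
  p∣sum = subst (+ suc q ∣_) (trans (cong (λ a → sumBelow (suc q) F - a) vanish) (ℤ.+-identityʳ (sumBelow (suc q) F)))
                (sumBelow≡altBinomialSum-mod-prime isPrime F)
  p∣trues : + length window ∣ sumℤ (map toℤ window)
  p∣trues = subst₂ (λ n x → + n ∣ x) (sym (length-applyUpTo (b ∘ (s ℕ.+_)) (suc q)))
                   (cong sumℤ (sym (map-applyUpTo (b ∘ (s ℕ.+_)) toℤ (suc q)))) p∣sum

windows-constant⇒constant : ∀ {q N} (b : ℕ → Bool) → 1 ≤ q → q ≤ N →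
  (∀ s → s ℕ.+ q ≤ N → ∀ i → s ≤ i → i ≤ s ℕ.+ q → b i ≡ b s) → ∀ j → j ≤ N → b j ≡ b 0
windows-constant⇒constant b 1≤q q≤N window zero    _   = refl
windows-constant⇒constant {q} {N} b 1≤q q≤N window (suc j) j<N with suc j ≤? q
... | yes j<q = window 0 q≤N (suc j) z≤n j<q
... | no  j≮q = begin
  b (suc j) ≡⟨ window s s+q≤N (suc j) (ℕ.m∸n≤m (suc j) q) (ℕ.≤-reflexive (sym s+q≡1+j)) ⟩
  b s       ≡⟨ window s s+q≤N j (ℕ.∸-monoʳ-≤ (suc j) 1≤q) (subst (j ≤_) (sym s+q≡1+j) (ℕ.n≤1+n j)) ⟨
  b j       ≡⟨ windows-constant⇒constant b 1≤q q≤N window j (ℕ.<⇒≤ j<N) ⟩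
  b 0       ∎
  where
  open ≡-Reasoning
  s = suc j ∸ q
  s+q≡1+j : s ℕ.+ q ≡ suc j
  s+q≡1+j = ℕ.m∸n+n≡m (ℕ.<⇒≤ (ℕ.≰⇒> j≮q))
  s+q≤N : s ℕ.+ q ≤ N
  s+q≤N = subst (_≤ N) (sym s+q≡1+j) j<N

vanishesBetween⇒constant : ∀ {q N} → Prime (suc q) → q ≤ N → (b : ℕ → Bool) →
  VanishesBetween (toℤ ∘ b) q N → ∀ j → j ≤ N → b j ≡ b 0
vanishesBetween⇒constant {q} isPrime q≤N b vanish =
  windows-constant⇒constant b 1≤q q≤N λ s s+q≤N → altBinomialSum≡0⇒window-constant isPrime b s
    (vanishesBetween-shift s (λ m q≤m m≤s+q → vanish m q≤m (ℕ.≤-trans m≤s+q s+q≤N)) q ℕ.≤-refl ℕ.≤-refl)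
  where
  1≤q : 1 ≤ q
  1≤q = ℕ.n≢0⇒n>0 λ { refl → ¬prime[1] isPrime }

nonvanishing-or-constant : ∀ {q N} → Prime (suc q) → q ≤ N → (b : ℕ → Bool) →
  (∃ λ m → q ≤ m × m ≤ N × altBinomialSum (toℤ ∘ b) m ≢ 0ℤ) ⊎ (∀ j → j ≤ N → b j ≡ b 0)
nonvanishing-or-constant {q} {N} isPrime q≤N b
  with ℕ.anyUpTo? (λ m → q ≤? m ×-dec ¬? (altBinomialSum (toℤ ∘ b) m ℤ.≟ 0ℤ)) (suc N)
... | yes (m , m<1+N , q≤m , ≢0) = inj₁ (m , q≤m , ℕ.≤-pred m<1+N , ≢0)
... | no ∄ = inj₂ (vanishesBetween⇒constant isPrime q≤N b λ m q≤m m≤N →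
  decidable-stable (_ ℤ.≟ 0ℤ) λ ≢0 → ∄ (m , s≤s m≤N , q≤m , ≢0))

-- Counting edges

UPair-≡ : ∀ {k} {e e′ : UPair k} → proj₁ e ≡ proj₁ e′ → e ≡ e′
UPair-≡ {e = _ , i<j} {e′ = _ , i<j′} refl = cong (_ ,_) (ℕ.<-irrelevant i<j i<j′)

T-eqPair : ∀ {k} (e e′ : UPair k) → T (eqPair e e′) ⇔ e ≡ e′
T-eqPair ((i , j) , _) ((i′ , j′) , _) with i Fin.≟ i′ | j Fin.≟ j′
... | yes refl | yes refl = mk⇔ (λ _ → UPair-≡ refl) (λ _ → _)
... | yes _    | no j≢j′  = mk⇔ (λ ()) (λ { refl → j≢j′ refl })
... | no i≢i′  | _        = mk⇔ (λ ()) (λ { refl → i≢i′ refl })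

spanning-∈ : ∀ {k} (S : List (UPair k)) {e} → T (spanning S e) ⇔ e ∈ S
spanning-∈ S {e} = mk⇔
  (Any.map (Equivalence.to (T-eqPair e _)) ∘ Equivalence.from any⇔)
  (Equivalence.to any⇔ ∘ Any.map (Equivalence.from (T-eqPair e _)))

ordered? : ∀ {k} (p : Fin k × Fin k) → Dec (proj₁ p Fin.< proj₂ p)
ordered? (i , j) = i Fin.<? j

collect-filter : ∀ {k} (xs : List (Fin k × Fin k)) → map proj₁ (collect xs) ≡ filter ordered? xs
collect-filter []             = refl
collect-filter ((i , j) ∷ xs) with i Fin.<? j
... | yes i<j = trans (cong ((i , j) ∷_) (collect-filter xs)) (sym (filter-accept ordered? i<j))
... | no  i≮j = trans (collect-filter xs) (sym (filter-reject ordered? i≮j))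

allPairs-unique : ∀ k → Unique (allPairs k)
allPairs-unique k = Unique.map⁻ {f = proj₁} (subst Unique (sym (collect-filter (cartesianProduct (allFin k) (allFin k))))
  (Unique.filter⁺ ordered? (Unique.cartesianProduct⁺ (Unique.allFin⁺ k) (Unique.allFin⁺ k))))

∈-allPairs : ∀ {k} (e : UPair k) → e ∈ allPairs k
∈-allPairs {k} ((i , j) , i<j)
  with ∈-map⁻ proj₁ (subst ((i , j) ∈_) (sym (collect-filter (cartesianProduct (allFin k) (allFin k))))
         (∈-filter⁺ ordered? (∈-cartesianProduct⁺ (∈-allFin i) (∈-allFin j)) i<j))
... | e′ , e′∈allPairs , ij≡e′ = subst (_∈ allPairs k) (UPair-≡ (sym ij≡e′)) e′∈allPairs

numEdges-spanning : ∀ {k} {S : List (UPair k)} → Unique S → numEdges (spanning S) ≡ length S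
numEdges-spanning {k} {S} S-unique =
  ↭-length (∼bag⇒↭ (unique∧set⇒bag (Unique.filter⁺ (T? ∘ spanning S) (allPairs-unique k)) S-unique sameMembers))
  where
  sameMembers : ∀ {e} → e ∈ edges (spanning S) ⇔ e ∈ S
  sameMembers = mk⇔ (Equivalence.to (spanning-∈ S) ∘ proj₂ ∘ ∈-filter⁻ (T? ∘ spanning S) {xs = allPairs k})
                    (λ e∈S → ∈-filter⁺ (T? ∘ spanning S) (∈-allPairs _) (Equivalence.from (spanning-∈ S) e∈S))

liftPair : ∀ {k} → UPair k → UPair (suc k)
liftPair ((i , j) , i<j) = (Fin.suc i , Fin.suc j) , s<s i<j

liftPair-injective : ∀ {k} {e e′ : UPair k} → liftPair e ≡ liftPair e′ → e ≡ e′
liftPair-injective {e = (_ , _) , _} {e′ = (_ , _) , _} refl = refl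

pairWith0 : ∀ {k} → Fin k → UPair (suc k)
pairWith0 j = (Fin.zero , Fin.suc j) , z<s

-- The pairs through vertex 0 come last, so that long enough initial segments contain all
-- pairs among the top vertices (∈-take-pairs).
pairs : ∀ k → List (UPair k)
pairs zero    = []
pairs (suc k) = map liftPair (pairs k) ++ map pairWith0 (allFin k)

pairs-unique : ∀ k → Unique (pairs k)
pairs-unique zero    = []
pairs-unique (suc k) = Unique.++⁺ (Unique.map⁺ liftPair-injective (pairs-unique k))
                                  (Unique.map⁺ (λ { refl → refl }) (Unique.allFin⁺ k)) disjoint
  where
  disjoint : Disjoint (map liftPair (pairs k)) (map pairWith0 (allFin k))
  disjoint (e∈lifted , e∈with0) with ∈-map⁻ liftPair e∈lifted | ∈-map⁻ pairWith0 e∈with0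
  ... | _ , _ , refl | _ , _ , ()

∈-pairs : ∀ {k} (e : UPair k) → e ∈ pairs k
∈-pairs {suc k} ((Fin.zero  , Fin.zero)  , ())
∈-pairs {suc k} ((Fin.zero  , Fin.suc j) , z<s)     = ∈-++⁺ʳ (map liftPair (pairs k)) (∈-map⁺ pairWith0 (∈-allFin j))
∈-pairs {suc k} ((Fin.suc i , Fin.zero)  , ())
∈-pairs {suc k} ((Fin.suc i , Fin.suc j) , s<s i<j) = ∈-++⁺ˡ (∈-map⁺ liftPair (∈-pairs ((i , j) , i<j)))

C2-suc : ∀ n → suc n C 2 ≡ n ℕ.+ n C 2
C2-suc n = trans (sym (nCk+nC[k+1]≡[n+1]C[k+1] n 1)) (cong (ℕ._+ n C 2) (nC1≡n n))

C2-mono-< : ∀ {m n} → 1 ≤ m → m < n → m C 2 < n C 2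
C2-mono-< {m} {suc n} 1≤m m<1+n with ℕ.m<1+n⇒m<n∨m≡n m<1+n
... | inj₁ m<n  = ℕ.<-≤-trans (C2-mono-< 1≤m m<n) (subst (n C 2 ≤_) (sym (C2-suc n)) (ℕ.m≤n+m (n C 2) n))
... | inj₂ refl = subst (m C 2 <_) (sym (C2-suc m)) (ℕ.+-monoˡ-≤ (m C 2) 1≤m)

C2-cancel-≤ : ∀ {ℓ k} → 1 ≤ k → ℓ C 2 ≤ k C 2 → ℓ ≤ k
C2-cancel-≤ 1≤k ℓC2≤kC2 = ℕ.≮⇒≥ λ k<ℓ → ℕ.<⇒≱ (C2-mono-< 1≤k k<ℓ) ℓC2≤kC2

length-pairs : ∀ k → length (pairs k) ≡ k C 2
length-pairs zero    = refl
length-pairs (suc k) = begin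
  length (map liftPair (pairs k) ++ map pairWith0 (allFin k))
    ≡⟨ length-++ (map liftPair (pairs k)) ⟩
  length (map liftPair (pairs k)) ℕ.+ length (map pairWith0 (allFin k))
    ≡⟨ cong₂ ℕ._+_ (trans (length-map liftPair (pairs k)) (length-pairs k))
                   (trans (length-map pairWith0 (allFin k)) (length-tabulate id)) ⟩
  k C 2 ℕ.+ k
    ≡⟨ ℕ.+-comm (k C 2) k ⟩
  k ℕ.+ k C 2
    ≡⟨ C2-suc k ⟨
  suc k C 2 ∎
  where open ≡-Reasoning

∈-take-++ : ∀ {A : Set} m (xs ys : List A) {x} → x ∈ take m xs → x ∈ take m (xs ++ ys)
∈-take-++ (suc m) (x ∷ xs) ys (here refl) = here refl
∈-take-++ (suc m) (x ∷ xs) ys (there x∈)  = there (∈-take-++ m xs ys x∈)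

∈-take-pairs : ∀ {k m} a → (k ∸ a) C 2 ≤ m → (e : UPair k) → a ≤ Fin.toℕ (proj₁ (proj₁ e)) →
  e ∈ take m (pairs k)
∈-take-pairs {k} {m} zero kC2≤m e _ =
  subst (e ∈_) (sym (take-all m (pairs k) (subst (_≤ m) (sym (length-pairs k)) kC2≤m))) (∈-pairs e)
∈-take-pairs {suc k} (suc a) _ ((Fin.zero , _) , _) ()
∈-take-pairs {suc k} (suc a) _ ((Fin.suc i , Fin.zero) , ()) _
∈-take-pairs {suc k} {m} (suc a) C2≤m ((Fin.suc i , Fin.suc j) , s<s i<j) (s≤s a≤i) =
  ∈-take-++ m (map liftPair (pairs k)) _ (subst (liftPair ((i , j) , i<j) ∈_) (sym (take-map m (pairs k)))
    (∈-map⁺ liftPair (∈-take-pairs a C2≤m ((i , j) , i<j) a≤i)))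

firstPairs : ∀ {k} → ℕ → Graph k
firstPairs {k} m = spanning (take m (pairs k))

numEdges-firstPairs : ∀ {k m} → m ≤ k C 2 → numEdges (firstPairs {k} m) ≡ m
numEdges-firstPairs {k} {m} m≤kC2 = begin
  numEdges (firstPairs {k} m) ≡⟨ numEdges-spanning (Unique.take⁺ m (pairs-unique k)) ⟩
  length (take m (pairs k))   ≡⟨ length-take m (pairs k) ⟩
  m ℕ.⊓ length (pairs k)      ≡⟨ cong (m ℕ.⊓_) (length-pairs k) ⟩
  m ℕ.⊓ (k C 2)               ≡⟨ ℕ.m≤n⇒m⊓n≡m m≤kC2 ⟩
  m                           ∎
  where open ≡-Reasoning

numEdges≤C2 : ∀ {k} (G : Graph k) → numEdges G ≤ k C 2
numEdges≤C2 {k} G = subst (numEdges G ≤_) length-allPairs (length-filter (T? ∘ G) (allPairs k))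
  where
  open ≡-Reasoning
  length-allPairs : length (allPairs k) ≡ k C 2
  length-allPairs = begin
    length (allPairs k)
      ≡⟨ cong length (filter-all (T? ∘ spanning (pairs k))
           (All.universal (λ e → Equivalence.from (spanning-∈ (pairs k)) (∈-pairs e)) (allPairs k))) ⟨
    numEdges (spanning (pairs k)) ≡⟨ numEdges-spanning (pairs-unique k) ⟩
    length (pairs k)              ≡⟨ length-pairs k ⟩
    k C 2                         ∎

-- Cliques

adj-clique : ∀ {k} (G : Graph k) (P : Fin k → Set) →
  (∀ {x y} (x<y : x Fin.< y) → P x → P y → G ((x , y) , x<y) ≡ true) →
  ∀ {a b} → a ≢ b → P a → P b → adj G a b ≡ true
adj-clique G P clique {a} {b} a≢b Pa Pb with a Fin.<? b | b Fin.<? a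
... | yes a<b | _       = clique a<b Pa Pb
... | no _    | yes b<a = clique b<a Pb Pa
... | no a≮b  | no b≮a  = contradiction (Finₚ.toℕ-injective (ℕ.≤-antisym (ℕ.≮⇒≥ b≮a) (ℕ.≮⇒≥ a≮b))) a≢b

topVertex : ∀ {k ℓ} → ℓ ≤ k → Fin ℓ → Fin k
topVertex {k} {ℓ} ℓ≤k i = Fin.fromℕ< (subst ((k ∸ ℓ) ℕ.+ Fin.toℕ i <_) (ℕ.m∸n+n≡m ℓ≤k)
                                            (ℕ.+-monoʳ-< (k ∸ ℓ) (Finₚ.toℕ<n i)))

toℕ-topVertex : ∀ {k ℓ} (ℓ≤k : ℓ ≤ k) i → Fin.toℕ (topVertex ℓ≤k i) ≡ (k ∸ ℓ) ℕ.+ Fin.toℕ i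
toℕ-topVertex ℓ≤k i = Finₚ.toℕ-fromℕ< _

topVertex-injective : ∀ {k ℓ} (ℓ≤k : ℓ ≤ k) → Injective _≡_ _≡_ (topVertex ℓ≤k)
topVertex-injective {k} {ℓ} ℓ≤k {i} {j} eq = Finₚ.toℕ-injective (ℕ.+-cancelˡ-≡ (k ∸ ℓ) _ _
  (trans (sym (toℕ-topVertex ℓ≤k i)) (trans (cong Fin.toℕ eq) (toℕ-topVertex ℓ≤k j))))

firstPairs-hasClique : ∀ {k ℓ m} → ℓ ≤ k → ℓ C 2 ≤ m → HasCliqueSubgraph ℓ (firstPairs {k} m)
firstPairs-hasClique {k} {ℓ} {m} ℓ≤k ℓC2≤m = topVertex ℓ≤k , topVertex-injective ℓ≤k , adjacent
  where
  IsTop : Fin k → Set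
  IsTop v = k ∸ ℓ ≤ Fin.toℕ v
  isTop : ∀ i → IsTop (topVertex ℓ≤k i)
  isTop i = subst (k ∸ ℓ ≤_) (sym (toℕ-topVertex ℓ≤k i)) (ℕ.m≤m+n (k ∸ ℓ) (Fin.toℕ i))
  topPair∈ : ∀ {x y} (x<y : x Fin.< y) → IsTop x → IsTop y → firstPairs m ((x , y) , x<y) ≡ true
  topPair∈ {x} {y} x<y top-x _ = Equivalence.to T-≡ (Equivalence.from (spanning-∈ (take m (pairs k)))
    (∈-take-pairs (k ∸ ℓ) (subst (λ n → n C 2 ≤ m) (sym (ℕ.m∸[m∸n]≡n ℓ≤k)) ℓC2≤m) ((x , y) , x<y) top-x))
  adjacent : ∀ i j → i ≢ j → adj (firstPairs m) (topVertex ℓ≤k i) (topVertex ℓ≤k j) ≡ true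
  adjacent i j i≢j = adj-clique (firstPairs m) IsTop topPair∈ (i≢j ∘ topVertex-injective ℓ≤k) (isTop i) (isTop j)

-- The alternating enumerator of a fully symmetric property

Unique-resp-⊆ : ∀ {A : Set} {xs ys : List A} → xs ⊆ ys → Unique ys → Unique xs
Unique-resp-⊆ []             []         = []
Unique-resp-⊆ (y ∷ʳ xs⊆ys)   (_ ∷ u)    = Unique-resp-⊆ xs⊆ys u
Unique-resp-⊆ (refl ∷ xs⊆ys) (y∉ys ∷ u) = All-resp-⊆ xs⊆ys y∉ys ∷ Unique-resp-⊆ xs⊆ys u

sublists-⊆ : ∀ {A : Set} (xs : List A) → All (_⊆ xs) (sublists xs)
sublists-⊆ []       = [] ∷ []
sublists-⊆ (x ∷ xs) = Allₚ.++⁺ (Allₚ.map⁺ (All.map (refl ∷_) (sublists-⊆ xs))) (All.map (x ∷ʳ_) (sublists-⊆ xs))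

sumℤ-++ : ∀ xs ys → sumℤ (xs ++ ys) ≡ sumℤ xs + sumℤ ys
sumℤ-++ []       ys = sym (ℤ.+-identityˡ (sumℤ ys))
sumℤ-++ (x ∷ xs) ys = trans (cong (ℤ._+_ x) (sumℤ-++ xs ys)) (sym (ℤ.+-assoc x (sumℤ xs) (sumℤ ys)))

sumℤ-map-neg : ∀ {A : Set} (g : A → ℤ) xs → sumℤ (map (λ x → - g x) xs) ≡ - sumℤ (map g xs)
sumℤ-map-neg g []       = refl
sumℤ-map-neg g (x ∷ xs) = trans (cong (ℤ._+_ (- g x)) (sumℤ-map-neg g xs)) (sym (ℤ.neg-distrib-+ (g x) _))

sumℤ-sublists : ∀ {A : Set} (G : ℕ → ℤ) (xs : List A) →
  sumℤ (map (λ S → sign (length S) * G (length S)) (sublists xs)) ≡ altBinomialSum G (length xs)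
sumℤ-sublists G []       = trans (ℤ.+-identityʳ _) (ℤ.*-identityˡ (G 0))
sumℤ-sublists G (x ∷ xs) = begin
  sumℤ (map term (map (x ∷_) Ss ++ Ss))
    ≡⟨ cong sumℤ (map-++ term (map (x ∷_) Ss) Ss) ⟩
  sumℤ (map term (map (x ∷_) Ss) ++ map term Ss)
    ≡⟨ sumℤ-++ (map term (map (x ∷_) Ss)) (map term Ss) ⟩
  sumℤ (map term (map (x ∷_) Ss)) + sumℤ (map term Ss)
    ≡⟨ cong₂ _+_ (cong sumℤ containingX) (sumℤ-sublists G xs) ⟩
  sumℤ (map (λ S → - term′ S) Ss) + altBinomialSum G n
    ≡⟨ cong (_+ altBinomialSum G n) (trans (sumℤ-map-neg term′ Ss) (cong -_ (sumℤ-sublists (G ∘ suc) xs))) ⟩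
  - altBinomialSum (G ∘ suc) n + altBinomialSum G n
    ≡⟨ ℤ.+-comm (- altBinomialSum (G ∘ suc) n) (altBinomialSum G n) ⟩
  altBinomialSum G n - altBinomialSum (G ∘ suc) n ∎
  where
  open ≡-Reasoning
  Ss = sublists xs
  n = length xs
  term term′ : List _ → ℤ
  term  S = sign (length S) * G (length S)
  term′ S = sign (length S) * G (suc (length S))
  containingX : map term (map (x ∷_) Ss) ≡ map (λ S → - term′ S) Ss
  containingX = trans (sym (map-∘ Ss)) (map-cong (λ S → sym (ℤ.neg-distribˡ-* (sign (length S)) _)) Ss)

sign*≡0⇒≡0 : ∀ n {x} → sign n * x ≡ 0ℤ → x ≡ 0ℤ
sign*≡0⇒≡0 zero    eq = trans (sym (ℤ.*-identityˡ _)) eq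
sign*≡0⇒≡0 (suc n) eq = sign*≡0⇒≡0 n (ℤ.neg-injective (trans (ℤ.neg-distribˡ-* (sign n) _) eq))

module Profile {k} (Φ : Graph k → Bool) (symmetric : FullySymmetric Φ) where

  φ : ℕ → Bool
  φ m = Φ (firstPairs m)

  Φ≡φ∘numEdges : ∀ G → Φ G ≡ φ (numEdges G)
  Φ≡φ∘numEdges G = symmetric G (firstPairs (numEdges G)) (sym (numEdges-firstPairs {k} (numEdges≤C2 G)))

  altEnum≡altBinomialSum : ∀ H → altEnum Φ H ≡ sign (numEdges H) * altBinomialSum (toℤ ∘ φ) (numEdges H)
  altEnum≡altBinomialSum H = cong (sign (numEdges H) *_)
    (trans (cong sumℤ (map-cong-local (All.map term≡ (sublists-⊆ (edges H)))))
           (sumℤ-sublists (toℤ ∘ φ) (edges H)))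
    where
    term≡ : ∀ {S} → S ⊆ edges H → sign (length S) * toℤ (Φ (spanning S)) ≡ sign (length S) * toℤ (φ (length S))
    term≡ {S} S⊆E = cong (λ b → sign (length S) * toℤ b) (trans (Φ≡φ∘numEdges (spanning S))
      (cong φ (numEdges-spanning (Unique-resp-⊆ S⊆E (Unique.filter⁺ (T? ∘ H) (allPairs-unique k))))))

  altEnum-firstPairs≢0 : ∀ {m} → m ≤ k C 2 → altBinomialSum (toℤ ∘ φ) m ≢ 0ℤ → altEnum Φ (firstPairs m) ≢ 0ℤ
  altEnum-firstPairs≢0 {m} m≤kC2 ≢0 eq = ≢0 (subst (λ n → altBinomialSum (toℤ ∘ φ) n ≡ 0ℤ)
    (numEdges-firstPairs {k} m≤kC2)
    (sign*≡0⇒≡0 (numEdges (firstPairs {k} m)) (trans (sym (altEnum≡altBinomialSum (firstPairs m))) eq)))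

  constant⇒trivial : (∀ j → j ≤ k C 2 → φ j ≡ φ 0) → Trivial Φ
  constant⇒trivial constant G G′ = begin
    Φ G             ≡⟨ Φ≡φ∘numEdges G ⟩
    φ (numEdges G)  ≡⟨ constant (numEdges G) (numEdges≤C2 G) ⟩
    φ 0             ≡⟨ constant (numEdges G′) (numEdges≤C2 G′) ⟨
    φ (numEdges G′) ≡⟨ Φ≡φ∘numEdges G′ ⟨
    Φ G′            ∎
    where open ≡-Reasoning

theorem5p11 : (k : ℕ) → 2 ≤ k → (Φ : Graph k → Bool) → IsGraphProperty Φ → FullySymmetric Φ → ¬ Trivial Φ
    → (ℓ : ℕ) → 2 ≤ ℓ → PrimeWindow k ℓ → (∀ ℓ' → ℓ < ℓ' → ¬ PrimeWindow k ℓ')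
    → Σ (Graph k) (λ H → (altEnum Φ H ≢ + 0) × HasCliqueSubgraph ℓ H)
theorem5p11 k _ Φ _ _ _ ℓ _ (zero , isPrime , _) _ = contradiction isPrime ¬prime[0]
theorem5p11 k 2≤k Φ _ symmetric nontrivial ℓ _ (suc q , isPrime , ℓC2+1≤p , p≤kC2+1) _ =
  [ (λ { (m , q≤m , m≤kC2 , ≢0) →
         firstPairs m , altEnum-firstPairs≢0 m≤kC2 ≢0 , firstPairs-hasClique ℓ≤k (ℕ.≤-trans ℓC2≤q q≤m) })
  , (λ constant → contradiction (constant⇒trivial constant) nontrivial)
  ]′ (nonvanishing-or-constant isPrime q≤kC2 φ)
  where
  open Profile Φ symmetric
  ℓC2≤q : ℓ C 2 ≤ q
  ℓC2≤q = ℕ.≤-pred (subst (_≤ suc q) (ℕ.+-comm (ℓ C 2) 1) ℓC2+1≤p)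
  q≤kC2 : q ≤ k C 2
  q≤kC2 = ℕ.≤-pred (subst (suc q ≤_) (ℕ.+-comm (k C 2) 1) p≤kC2+1)
  ℓ≤k : ℓ ≤ k
  ℓ≤k = C2-cancel-≤ (ℕ.≤-trans (s≤s z≤n) 2≤k) (ℕ.≤-trans ℓC2≤q q≤kC2)
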